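{- Let $L$ be a $\bar{d}$-regular graph on $\bar{n}$ vertices, $k\in\{1,\dots,\bar{n}-1\}$ and $\langle\mathfrak{v},\mathfrak{w}\rangle\in\mathfrak{E}_k$ and write $\mathfrak{v}\triangle\mathfrak{w}=\{v,w\}$. Then $\mathrm{deg}_k(\mathfrak{v})=\mathrm{deg}_k(\mathfrak{w})$ if and only if $\mathrm{deg}^{L_{\mathfrak{v}}}(v)=\mathrm{deg}^{L_{\mathfrak{w}}}(w)$.\\ Moreover, any $\mathfrak{v},\mathfrak{w}\in\mathfrak{V}_k$ with $\langle\mathfrak{v},\mathfrak{w}\rangle\in\mathfrak{E}_k$ and $\mathfrak{v}\triangle\mathfrak{w}=\{v,w\}$ satisfy \begin{equation} \mathrm{deg}^{L_{\mathfrak{v}}}(v) + \mathrm{deg}^{L_{V\backslash\mathfrak{w}}}(v) =\bar{d}-1. \end{equation}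
   Context: For a finite simple connected graph $L=(V,E)$ and $k\in\{1,\dots,|V|-1\}$, the $k$-particle graph $\mathfrak{L}_k=(\mathfrak{V}_k,\mathfrak{E}_k)$ has vertex set $\mathfrak{V}_k$ consisting of all subsets of $V$ of size $k$, and $\langle\mathfrak{v},\mathfrak{w}\rangle\in\mathfrak{E}_k$ if and only if $\mathfrak{v}\triangle\mathfrak{w}=\{v,w\}$ with $\langle v,w\rangle\in E$. $\mathrm{deg}_k(\mathfrak{v})$ is the degree of $\mathfrak{v}$ in $\mathfrak{L}_k$; for $U\subseteq V$, $L_U$ denotes the vertex induced sub-graph of $L$ on $U$ and $\mathrm{deg}^{L_U}(u)$ the degree of $u$ in $L_U$. -}

module Defs where

open import Data.Nat using (ℕ; zero; suc)
open import Data.Bool using (Bool; true; false)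
open import Data.Fin using (Fin)
open import Data.Fin.Properties using (any?)
open import Data.Fin.Subset using (Subset; _─_; _∪_; _∩_; ∣_∣; ⁅_⁆; ∁)
open import Data.Vec using (Vec; []; _∷_; tabulate)
import Data.Vec.Properties as VecP
open import Data.List using (List; []; _∷_; _++_; map; filter; length)
open import Data.Product using (Σ; _×_; _,_)
open import Relation.Binary.PropositionalEquality using (_≡_)
open import Relation.Nullary using (Dec)
open import Relation.Nullary.Decidable using (_×-dec_)
import Data.Bool.Properties as BoolP
import Data.Nat.Properties as NatP

record Graph (n : ℕ) : Set where
  field
    adj     : Fin n → Fin n → Bool
    adj-sym : ∀ x y → adj x y ≡ adj y x
    irrefl  : ∀ x → adj x x ≡ false

open Graph public

data Reachable {n : ℕ} (L : Graph n) : Fin n → Fin n → Set where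
  here : ∀ {x} → Reachable L x x
  step : ∀ {x y z} → adj L x y ≡ true → Reachable L y z → Reachable L x z

Connected : {n : ℕ} → Graph n → Set
Connected {n} L = ∀ (x y : Fin n) → Reachable L x y

nbhd : {n : ℕ} → Graph n → Fin n → Subset n
nbhd L x = tabulate (adj L x)

deg : {n : ℕ} → Graph n → Fin n → ℕ
deg L x = ∣ nbhd L x ∣

-- degree of u in the induced subgraph L_U (meaningful for u ∈ U)
degIn : {n : ℕ} → Graph n → Subset n → Fin n → ℕ
degIn L U u = ∣ U ∩ nbhd L u ∣

Regular : {n : ℕ} → Graph n → ℕ → Set
Regular L d = ∀ x → deg L x ≡ d

_△_ : {n : ℕ} → Subset n → Subset n → Subset n
p △ q = (p ─ q) ∪ (q ─ p)

-- edge relation of the k-particle graph (on subsets; k-size imposed separately)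
PEdge : {n : ℕ} → Graph n → Subset n → Subset n → Set
PEdge {n} L 𝔳 𝔴 = Σ (Fin n) λ x → Σ (Fin n) λ y →
  (adj L x y ≡ true) × (𝔳 △ 𝔴 ≡ ⁅ x ⁆ ∪ ⁅ y ⁆)

PEdge? : {n : ℕ} (L : Graph n) → ∀ 𝔳 𝔴 → Dec (PEdge L 𝔳 𝔴)
PEdge? L 𝔳 𝔴 = any? λ x → any? λ y →
  (adj L x y BoolP.≟ true) ×-dec VecP.≡-dec BoolP._≟_ (𝔳 △ 𝔴) (⁅ x ⁆ ∪ ⁅ y ⁆)

allSubsets : (n : ℕ) → List (Subset n)
allSubsets zero = [] ∷ []
allSubsets (suc n) = map (true ∷_) (allSubsets n) ++ map (false ∷_) (allSubsets n)

degK : {n : ℕ} → Graph n → ℕ → Subset n → ℕ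
degK {n} L k 𝔳 = length (filter (λ 𝔴 → (∣ 𝔴 ∣ NatP.≟ k) ×-dec PEdge? L 𝔳 𝔴) (allSubsets n))

-- The neighbours of a configuration p in the k-particle graph correspond bijectively to the
-- pairs (a , b) with a ∈ p, b ∉ p and a ~ b (move the particle at a to b), so deg_k(p) is the
-- number of edges leaving p.  In a d-regular graph this is k·d − 2·e(p), where e(p) counts
-- the edges inside p.  If p △ q = {v , w} with v ∈ p and w ∈ q, then p = C ⊎ {v} and
-- q = C ⊎ {w} for C = p ∩ q, so e(p) = e(C) + deg^{L_p}(v) and e(q) = e(C) + deg^{L_q}(w);
-- hence deg_k(p) − deg_k(q) = 2·(deg^{L_q}(w) − deg^{L_p}(v)).  For the second identity,
-- p and ∁ q cover V ∖ {w} and meet exactly in v, so the d neighbours of v are w, those in p,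
-- and those outside q.
--
-- Counts are sums of 0/1 indicators over Fin n; edge counts are values of the bilinear form
-- (f , g) ↦ Σ f(a) · A(a , b) · g(b) of the adjacency matrix A.

module Submission where

open import Defs
import Data.Nat as ℕ
open ℕ using (ℕ; zero; suc; _+_; _*_; _∸_; _≤_; _<_)
open import Data.Nat.Properties
  using (+-*-semiring; m+n∸n≡m; +-cancelˡ-≡; +-cancelʳ-≡; *-cancelˡ-≡; +-identityʳ; *-identityʳ; *-comm; *-distribˡ-+; *-distribʳ-+)
open import Data.Bool using (Bool; true; false; _∧_; _∨_; _xor_; not)
import Data.Bool.Properties as BoolP
open BoolP using (¬-not; ∧-identityʳ)
open import Data.Fin using (Fin; zero; suc; _≟_)
open import Data.Fin.Properties using (suc-injective)
open import Function using (_∘_; _⇔_; mk⇔)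
open import Data.Fin.Subset using (Subset; _∈_; _∉_; ∣_∣; ⁅_⁆; _∪_; _∩_; _─_; ∁; ⊤)
open import Data.Sum as Sum using (_⊎_; inj₁; inj₂)
import Data.Product as Product
open Product using (Σ; _×_; _,_; proj₂)
open import Data.Fin.Subset.Properties using (_∈?_; x∈⁅x⁆; x∈⁅y⁆⇒x≡y; x∈p∪q⁺; x∈p∪q⁻; ∪-comm; ∩-comm; ∩-identityˡ)
open import Data.Vec using ([]; _∷_; lookup)
open import Data.List using (List; []; _∷_; _++_; map; filter; length)
open import Data.List.Properties using (map-++; map-∘; map-cong)
open import Data.Nat.ListAction using () renaming (sum to sumᴸ)
open import Data.Nat.ListAction.Properties using (sum-++)
open import Data.Vec.Properties using (≡-dec; ∷-injectiveʳ; lookup∘tabulate; lookup-replicate; lookup-zipWith; lookup-map; []=⇒lookup; lookup⇒[]=)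
open import Relation.Binary.PropositionalEquality
open import Relation.Nullary using (Dec; yes; no; does; ¬_; contradiction)
open import Relation.Nullary.Decidable using (_×-dec_; ¬?; dec-true; dec-false)
open import Algebra.Properties.Semiring.Sum +-*-semiring
  using (sum-syntax; sum-replicate-zero; sum-cong-≗; ∑-distrib-+; *-distribʳ-sum; *-distribˡ-sum)
open import Data.Nat.Solver using (module +-*-Solver)
open +-*-Solver using (solve; _:+_; _:*_; _:=_; con)

𝟙 : Bool → ℕ
𝟙 true  = 1
𝟙 false = 0

𝟙-∧ : ∀ a b → 𝟙 (a ∧ b) ≡ 𝟙 a * 𝟙 b
𝟙-∧ true  b = sym (+-identityʳ (𝟙 b))
𝟙-∧ false b = refl

𝟙-not : ∀ a → 𝟙 (not a) + 𝟙 a ≡ 1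
𝟙-not true  = refl
𝟙-not false = refl

𝟙-xor : ∀ a b → 𝟙 (a xor b) + 2 * (𝟙 a * 𝟙 b) ≡ 𝟙 a + 𝟙 b
𝟙-xor true  true  = refl
𝟙-xor true  false = refl
𝟙-xor false true  = refl
𝟙-xor false false = refl

𝟙-yes : ∀ {A : Set} (A? : Dec A) → A → 𝟙 (does A?) ≡ 1
𝟙-yes A? a = cong 𝟙 (dec-true A? a)

𝟙-no : ∀ {A : Set} (A? : Dec A) → ¬ A → 𝟙 (does A?) ≡ 0
𝟙-no A? ¬a = cong 𝟙 (dec-false A? ¬a)

∑-zero : ∀ {n} {f : Fin n → ℕ} → (∀ i → f i ≡ 0) → ∑[ i < n ] f i ≡ 0
∑-zero {n} f≗0 = trans (sum-cong-≗ f≗0) (sum-replicate-zero n)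

∑-concentrated : ∀ {n} (f : Fin n → ℕ) (x : Fin n) → (∀ i → i ≢ x → f i ≡ 0) → ∑[ i < n ] f i ≡ f x
∑-concentrated f zero    vanish = trans (cong (f zero +_) (∑-zero λ i → vanish (suc i) λ ())) (+-identityʳ (f zero))
∑-concentrated f (suc x) vanish =
  cong₂ _+_ (vanish zero λ ()) (∑-concentrated (λ i → f (suc i)) x (λ i i≢x → vanish (suc i) (i≢x ∘ suc-injective)))

∑₂-concentrated : ∀ {m n} (f : Fin m → Fin n → ℕ) x y → (∀ a b → a ≢ x ⊎ b ≢ y → f a b ≡ 0) →
                  ∑[ a < m ] ∑[ b < n ] f a b ≡ f x y
∑₂-concentrated f x y vanish =
  trans (∑-concentrated _ x (λ a a≢x → ∑-zero (λ b → vanish a b (inj₁ a≢x))))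
        (∑-concentrated (f x) y (λ b b≢y → vanish x b (inj₂ b≢y)))

length-filter≡sum : ∀ {A : Set} {P : A → Set} (P? : ∀ x → Dec (P x)) xs →
                    length (filter P? xs) ≡ sumᴸ (map (λ x → 𝟙 (does (P? x))) xs)
length-filter≡sum P? []       = refl
length-filter≡sum P? (x ∷ xs) with does (P? x)
... | true  = cong suc (length-filter≡sum P? xs)
... | false = length-filter≡sum P? xs

sumᴸ-∑-comm : ∀ {A : Set} {m} (f : A → Fin m → ℕ) xs →
              sumᴸ (map (λ s → ∑[ i < m ] f s i) xs) ≡ ∑[ i < m ] sumᴸ (map (λ s → f s i) xs)
sumᴸ-∑-comm {m = m} f []       = sym (∑-zero {m} (λ _ → refl))
sumᴸ-∑-comm {m = m} f (x ∷ xs) = trans (cong (∑[ i < m ] f x i +_) (sumᴸ-∑-comm f xs)) (sym (∑-distrib-+ (f x) _))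

-- Subsets as indicator functions

χ : ∀ {n} → Subset n → Fin n → ℕ
χ p i = 𝟙 (lookup p i)

lookup⁅⁆-self : ∀ {n} (x : Fin n) → lookup ⁅ x ⁆ x ≡ true
lookup⁅⁆-self x = []=⇒lookup (x∈⁅x⁆ x)

lookup⁅⁆-other : ∀ {n} {x i : Fin n} → i ≢ x → lookup ⁅ x ⁆ i ≡ false
lookup⁅⁆-other {x = x} {i} i≢x = ¬-not λ e → i≢x (x∈⁅y⁆⇒x≡y x (lookup⇒[]= i ⁅ x ⁆ e))

χ⁅⁆-self : ∀ {n} (x : Fin n) → χ ⁅ x ⁆ x ≡ 1
χ⁅⁆-self x = cong 𝟙 (lookup⁅⁆-self x)

χ⁅⁆-other : ∀ {n} {x i : Fin n} → i ≢ x → χ ⁅ x ⁆ i ≡ 0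
χ⁅⁆-other i≢x = cong 𝟙 (lookup⁅⁆-other i≢x)

∑-χ⁅⁆ˡ : ∀ {n} (x : Fin n) (f : Fin n → ℕ) → ∑[ i < n ] (χ ⁅ x ⁆ i * f i) ≡ f x
∑-χ⁅⁆ˡ x f = trans (∑-concentrated _ x (λ i i≢x → cong (_* f i) (χ⁅⁆-other i≢x)))
                   (trans (cong (_* f x) (χ⁅⁆-self x)) (+-identityʳ (f x)))

∑-χ⁅⁆ʳ : ∀ {n} (x : Fin n) (f : Fin n → ℕ) → ∑[ i < n ] (f i * χ ⁅ x ⁆ i) ≡ f x
∑-χ⁅⁆ʳ x f = trans (sum-cong-≗ (λ i → *-comm (f i) (χ ⁅ x ⁆ i))) (∑-χ⁅⁆ˡ x f)

∣p∣≡∑χ : ∀ {n} (p : Subset n) → ∣ p ∣ ≡ ∑[ i < n ] χ p i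
∣p∣≡∑χ []          = refl
∣p∣≡∑χ (true  ∷ p) = cong suc (∣p∣≡∑χ p)
∣p∣≡∑χ (false ∷ p) = ∣p∣≡∑χ p

χ-∩ : ∀ {n} (p q : Subset n) i → χ (p ∩ q) i ≡ χ p i * χ q i
χ-∩ p q i = trans (cong 𝟙 (lookup-zipWith _∧_ i p q)) (𝟙-∧ (lookup p i) (lookup q i))

χ-∁ : ∀ {n} (p : Subset n) i → χ (∁ p) i + χ p i ≡ 1
χ-∁ p i = trans (cong (λ b → 𝟙 b + χ p i) (lookup-map i not p)) (𝟙-not (lookup p i))

lookup-∪ : ∀ {n} (p q : Subset n) i → lookup (p ∪ q) i ≡ lookup p i ∨ lookup q i
lookup-∪ p q i = lookup-zipWith _∨_ i p q

lookup-△ : ∀ {n} (p q : Subset n) i → lookup (p △ q) i ≡ lookup p i xor lookup q i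
lookup-△ (true  ∷ p) (true  ∷ q) zero    = refl
lookup-△ (true  ∷ p) (false ∷ q) zero    = refl
lookup-△ (false ∷ p) (true  ∷ q) zero    = refl
lookup-△ (false ∷ p) (false ∷ q) zero    = refl
lookup-△ (_     ∷ p) (_     ∷ q) (suc i) = lookup-△ p q i

△-involutive : ∀ {n} (p q : Subset n) → p △ (p △ q) ≡ q
△-involutive []          []          = refl
△-involutive (true  ∷ p) (true  ∷ q) = cong (true  ∷_) (△-involutive p q)
△-involutive (true  ∷ p) (false ∷ q) = cong (false ∷_) (△-involutive p q)
△-involutive (false ∷ p) (true  ∷ q) = cong (true  ∷_) (△-involutive p q)
△-involutive (false ∷ p) (false ∷ q) = cong (false ∷_) (△-involutive p q)

△-comm : ∀ {n} (p q : Subset n) → p △ q ≡ q △ p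
△-comm p q = ∪-comm (p ─ q) (q ─ p)

△-flip : ∀ {n} {p q : Subset n} {v w} → p △ q ≡ ⁅ v ⁆ ∪ ⁅ w ⁆ → q △ p ≡ ⁅ w ⁆ ∪ ⁅ v ⁆
△-flip {p = p} {q} {v} {w} p△q≡r = trans (△-comm q p) (trans p△q≡r (∪-comm ⁅ v ⁆ ⁅ w ⁆))

∉⇒lookup≡false : ∀ {n} {x : Fin n} {p} → x ∉ p → lookup p x ≡ false
∉⇒lookup≡false {x = x} {p} x∉p = ¬-not (x∉p ∘ lookup⇒[]= x p)

lookup≡false⇒∉ : ∀ {n} {x : Fin n} {p} → lookup p x ≡ false → x ∉ p
lookup≡false⇒∉ px x∈p with () ← trans (sym ([]=⇒lookup x∈p)) px

∈∧∉⇒≢ : ∀ {n} {x y : Fin n} {p} → x ∈ p → y ∉ p → x ≢ y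
∈∧∉⇒≢ x∈p y∉p refl = y∉p x∈p

∈q∧∈p△q⇒∉p : ∀ {n} {x : Fin n} {p q} → x ∈ q → x ∈ p △ q → x ∉ p
∈q∧∈p△q⇒∉p {x = x} {p} {q} x∈q x∈p△q x∈p
  with () ← trans (sym ([]=⇒lookup x∈p△q)) (trans (lookup-△ p q x) (cong₂ _xor_ ([]=⇒lookup x∈p) ([]=⇒lookup x∈q)))

∈⁅⁆∪⁅⁆⁻ : ∀ {n} {x a b : Fin n} → x ∈ ⁅ a ⁆ ∪ ⁅ b ⁆ → x ≡ a ⊎ x ≡ b
∈⁅⁆∪⁅⁆⁻ {a = a} {b} x∈ = Sum.map (x∈⁅y⁆⇒x≡y a) (x∈⁅y⁆⇒x≡y b) (x∈p∪q⁻ ⁅ a ⁆ ⁅ b ⁆ x∈)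

⁅⁆∪⁅⁆-endpoints : ∀ {n} {p : Subset n} {a b a′ b′} → a ∈ p → b ∉ p → a′ ∈ p → b′ ∉ p →
                  ⁅ a ⁆ ∪ ⁅ b ⁆ ≡ ⁅ a′ ⁆ ∪ ⁅ b′ ⁆ → a ≡ a′ × b ≡ b′
⁅⁆∪⁅⁆-endpoints {p = p} {a} {b} {a′} {b′} a∈p b∉p a′∈p b′∉p eq = in-p , out-p
  where
  ∈rhs : ∀ {x} → x ∈ ⁅ a ⁆ ∪ ⁅ b ⁆ → x ≡ a′ ⊎ x ≡ b′
  ∈rhs x∈ = ∈⁅⁆∪⁅⁆⁻ (subst (_ ∈_) eq x∈)
  in-p : a ≡ a′
  in-p with ∈rhs (x∈p∪q⁺ (inj₁ (x∈⁅x⁆ a)))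
  ... | inj₁ a≡a′   = a≡a′
  ... | inj₂ refl   = contradiction a∈p b′∉p
  out-p : b ≡ b′
  out-p with ∈rhs (x∈p∪q⁺ (inj₂ (x∈⁅x⁆ b)))
  ... | inj₁ refl   = contradiction a′∈p b∉p
  ... | inj₂ b≡b′   = b≡b′

∣p△q∣+2∣p∩q∣ : ∀ {n} (p q : Subset n) → ∣ p △ q ∣ + 2 * ∣ p ∩ q ∣ ≡ ∣ p ∣ + ∣ q ∣
∣p△q∣+2∣p∩q∣ {n} p q = begin
  ∣ p △ q ∣ + 2 * ∣ p ∩ q ∣
    ≡⟨ cong₂ (λ x y → x + 2 * y) (∣p∣≡∑χ (p △ q)) (∣p∣≡∑χ (p ∩ q)) ⟩
  ∑[ i < n ] χ (p △ q) i + 2 * ∑[ i < n ] χ (p ∩ q) i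
    ≡⟨ cong (∑[ i < n ] χ (p △ q) i +_) (*-distribˡ-sum 2 (χ (p ∩ q))) ⟩
  ∑[ i < n ] χ (p △ q) i + ∑[ i < n ] (2 * χ (p ∩ q) i)
    ≡⟨ ∑-distrib-+ (χ (p △ q)) (λ i → 2 * χ (p ∩ q) i) ⟨
  ∑[ i < n ] (χ (p △ q) i + 2 * χ (p ∩ q) i)
    ≡⟨ sum-cong-≗ (λ i → trans (cong₂ (λ a b → 𝟙 a + 2 * b) (lookup-△ p q i) (χ-∩ p q i)) (𝟙-xor (lookup p i) (lookup q i))) ⟩
  ∑[ i < n ] (χ p i + χ q i)
    ≡⟨ ∑-distrib-+ (χ p) (χ q) ⟩
  ∑[ i < n ] χ p i + ∑[ i < n ] χ q i
    ≡⟨ cong₂ _+_ (∣p∣≡∑χ p) (∣p∣≡∑χ q) ⟨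
  ∣ p ∣ + ∣ q ∣
    ∎
  where open ≡-Reasoning

χ-⁅⁆∪⁅⁆ : ∀ {n} {x y : Fin n} → x ≢ y → ∀ i → χ (⁅ x ⁆ ∪ ⁅ y ⁆) i ≡ χ ⁅ x ⁆ i + χ ⁅ y ⁆ i
χ-⁅⁆∪⁅⁆ {x = x} {y} x≢y i with i ≟ x
... | yes refl = trans (cong 𝟙 (trans (lookup-∪ ⁅ x ⁆ ⁅ y ⁆ x) (cong₂ _∨_ (lookup⁅⁆-self x) (lookup⁅⁆-other x≢y))))
                       (sym (cong₂ _+_ (χ⁅⁆-self x) (χ⁅⁆-other x≢y)))
... | no  i≢x  = trans (cong 𝟙 (trans (lookup-∪ ⁅ x ⁆ ⁅ y ⁆ i) (cong (_∨ lookup ⁅ y ⁆ i) (lookup⁅⁆-other i≢x))))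
                       (sym (cong (_+ χ ⁅ y ⁆ i) (χ⁅⁆-other i≢x)))

∣p∩⁅⁆∪⁅⁆∣ : ∀ {n} (p : Subset n) {x y} → x ≢ y → ∣ p ∩ (⁅ x ⁆ ∪ ⁅ y ⁆) ∣ ≡ χ p x + χ p y
∣p∩⁅⁆∪⁅⁆∣ {n} p {x} {y} x≢y = begin
  ∣ p ∩ (⁅ x ⁆ ∪ ⁅ y ⁆) ∣
    ≡⟨ ∣p∣≡∑χ (p ∩ (⁅ x ⁆ ∪ ⁅ y ⁆)) ⟩
  ∑[ i < n ] χ (p ∩ (⁅ x ⁆ ∪ ⁅ y ⁆)) i
    ≡⟨ sum-cong-≗ (λ i → trans (χ-∩ p _ i) (trans (cong (χ p i *_) (χ-⁅⁆∪⁅⁆ x≢y i)) (*-distribˡ-+ (χ p i) _ _))) ⟩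
  ∑[ i < n ] (χ p i * χ ⁅ x ⁆ i + χ p i * χ ⁅ y ⁆ i)
    ≡⟨ ∑-distrib-+ (λ i → χ p i * χ ⁅ x ⁆ i) (λ i → χ p i * χ ⁅ y ⁆ i) ⟩
  ∑[ i < n ] (χ p i * χ ⁅ x ⁆ i) + ∑[ i < n ] (χ p i * χ ⁅ y ⁆ i)
    ≡⟨ cong₂ _+_ (∑-χ⁅⁆ʳ x (χ p)) (∑-χ⁅⁆ʳ y (χ p)) ⟩
  χ p x + χ p y
    ∎
  where open ≡-Reasoning

∣⁅⁆∪⁅⁆∣ : ∀ {n} {x y : Fin n} → x ≢ y → ∣ ⁅ x ⁆ ∪ ⁅ y ⁆ ∣ ≡ 2
∣⁅⁆∪⁅⁆∣ {n} {x} {y} x≢y = begin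
  ∣ ⁅ x ⁆ ∪ ⁅ y ⁆ ∣                      ≡⟨ cong ∣_∣ (∩-identityˡ (⁅ x ⁆ ∪ ⁅ y ⁆)) ⟨
  ∣ ⊤ ∩ (⁅ x ⁆ ∪ ⁅ y ⁆) ∣                 ≡⟨ ∣p∩⁅⁆∪⁅⁆∣ ⊤ x≢y ⟩
  χ ⊤ x + χ ⊤ y                          ≡⟨ cong₂ (λ a b → 𝟙 a + 𝟙 b) (lookup-replicate x true) (lookup-replicate y true) ⟩
  2                                      ∎
  where open ≡-Reasoning

∣p△⁅⁆∪⁅⁆∣ : ∀ {n} (p : Subset n) {x y} → x ≢ y → ∣ p △ (⁅ x ⁆ ∪ ⁅ y ⁆) ∣ + 2 * (χ p x + χ p y) ≡ ∣ p ∣ + 2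
∣p△⁅⁆∪⁅⁆∣ p {x} {y} x≢y = begin
  ∣ p △ r ∣ + 2 * (χ p x + χ p y)  ≡⟨ cong (λ z → ∣ p △ r ∣ + 2 * z) (∣p∩⁅⁆∪⁅⁆∣ p x≢y) ⟨
  ∣ p △ r ∣ + 2 * ∣ p ∩ r ∣        ≡⟨ ∣p△q∣+2∣p∩q∣ p r ⟩
  ∣ p ∣ + ∣ r ∣                    ≡⟨ cong (∣ p ∣ +_) (∣⁅⁆∪⁅⁆∣ x≢y) ⟩
  ∣ p ∣ + 2                        ∎
  where
  open ≡-Reasoning
  r : Subset _
  r = ⁅ x ⁆ ∪ ⁅ y ⁆

χ+χ≡1⇒one-in : ∀ {n} (p : Subset n) {x y} → χ p x + χ p y ≡ 1 → (x ∈ p × y ∉ p) ⊎ (y ∈ p × x ∉ p)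
χ+χ≡1⇒one-in p {x} {y} one with lookup p x in px | lookup p y in py
... | true  | false = inj₁ (lookup⇒[]= x p px , lookup≡false⇒∉ py)
... | false | true  = inj₂ (lookup⇒[]= y p py , lookup≡false⇒∉ px)
χ+χ≡1⇒one-in p () | true  | true
χ+χ≡1⇒one-in p () | false | false

does-∈? : ∀ {n} (x : Fin n) p → does (x ∈? p) ≡ lookup p x
does-∈? zero    (true  ∷ p) = refl
does-∈? zero    (false ∷ p) = refl
does-∈? (suc x) (_     ∷ p) = does-∈? x p

∑ₛ : ∀ {n} → (Subset n → ℕ) → ℕ
∑ₛ {n} h = sumᴸ (map h (allSubsets n))

∑ₛ-concentrated : ∀ {n} (h : Subset n → ℕ) t → (∀ s → s ≢ t → h s ≡ 0) → ∑ₛ h ≡ h t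
∑ₛ-concentrated {zero}  h [] _ = +-identityʳ (h [])
∑ₛ-concentrated {suc n} h (b ∷ t) vanish = begin
  sumᴸ (map h (map (true ∷_) S ++ map (false ∷_) S))
    ≡⟨ cong sumᴸ (map-++ h (map (true ∷_) S) _) ⟩
  sumᴸ (map h (map (true ∷_) S) ++ map h (map (false ∷_) S))
    ≡⟨ sum-++ (map h (map (true ∷_) S)) _ ⟩
  sumᴸ (map h (map (true ∷_) S)) + sumᴸ (map h (map (false ∷_) S))
    ≡⟨ cong₂ _+_ (cong sumᴸ (map-∘ S)) (cong sumᴸ (map-∘ S)) ⟨
  ∑ₛ (h ∘ (true ∷_)) + ∑ₛ (h ∘ (false ∷_))
    ≡⟨ halves b vanish ⟩
  h (b ∷ t)
    ∎
  where
  open ≡-Reasoning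
  S : List (Subset n)
  S = allSubsets n
  on-half : ∀ c → (∀ s → s ≢ c ∷ t → h s ≡ 0) → ∑ₛ (h ∘ (c ∷_)) ≡ h (c ∷ t)
  on-half c vanish′ = ∑ₛ-concentrated (h ∘ (c ∷_)) t (λ s s≢t → vanish′ (c ∷ s) (s≢t ∘ ∷-injectiveʳ))
  off-half : ∀ c → (∀ s → h (c ∷ s) ≡ 0) → ∑ₛ (h ∘ (c ∷_)) ≡ 0
  off-half c h≡0 = trans (∑ₛ-concentrated (h ∘ (c ∷_)) t (λ s _ → h≡0 s)) (h≡0 t)
  halves : ∀ b → (∀ s → s ≢ b ∷ t → h s ≡ 0) → ∑ₛ (h ∘ (true ∷_)) + ∑ₛ (h ∘ (false ∷_)) ≡ h (b ∷ t)
  halves true  vanish′ = trans (cong₂ _+_ (on-half true vanish′) (off-half false (λ s → vanish′ (false ∷ s) λ ()))) (+-identityʳ _)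
  halves false vanish′ = cong₂ _+_ (off-half true (λ s → vanish′ (true ∷ s) λ ())) (on-half false vanish′)

split-bool : ∀ a b x y → a xor b ≡ x ∨ y → (x ≡ true → a ≡ true) → (y ≡ true → b ≡ true) → 𝟙 a ≡ 𝟙 (a ∧ b) + 𝟙 x
split-bool true  true  false _     _  _  _  = refl
split-bool true  true  true  _     () _  _
split-bool true  false true  _     _  _  _  = refl
split-bool true  false false true  _  _  y⇒b with () ← y⇒b refl
split-bool true  false false false () _  _
split-bool false _     false _     _  _  _  = refl
split-bool false _     true  _     _  x⇒a _  with () ← x⇒a refl

χ-split : ∀ {n} {p q : Subset n} {v w} → p △ q ≡ ⁅ v ⁆ ∪ ⁅ w ⁆ → v ∈ p → w ∈ q →
          ∀ i → χ p i ≡ χ (p ∩ q) i + χ ⁅ v ⁆ i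
χ-split {p = p} {q} {v} {w} p△q≡r v∈p w∈q i =
  trans (split-bool (lookup p i) (lookup q i) (lookup ⁅ v ⁆ i) (lookup ⁅ w ⁆ i) xor≡∨ (marked v∈p) (marked w∈q))
        (cong (λ u → 𝟙 u + χ ⁅ v ⁆ i) (sym (lookup-zipWith _∧_ i p q)))
  where
  xor≡∨ : lookup p i xor lookup q i ≡ lookup ⁅ v ⁆ i ∨ lookup ⁅ w ⁆ i
  xor≡∨ = trans (sym (lookup-△ p q i)) (trans (cong (λ r → lookup r i) p△q≡r) (lookup-∪ ⁅ v ⁆ ⁅ w ⁆ i))
  marked : ∀ {x r} → x ∈ r → lookup ⁅ x ⁆ i ≡ true → lookup r i ≡ true
  marked {x} {r} x∈r i∈⁅x⁆ = subst (λ j → lookup r j ≡ true) (sym (x∈⁅y⁆⇒x≡y x (lookup⇒[]= i ⁅ x ⁆ i∈⁅x⁆))) ([]=⇒lookup x∈r)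

-- The adjacency form of a graph

module _ {n : ℕ} (L : Graph n) where

  adjℕ : Fin n → Fin n → ℕ
  adjℕ x y = 𝟙 (adj L x y)

  nbrSum : (Fin n → ℕ) → Fin n → ℕ
  nbrSum f x = ∑[ y < n ] (adjℕ x y * f y)

  adjForm : (Fin n → ℕ) → (Fin n → ℕ) → ℕ
  adjForm f g = ∑[ x < n ] (f x * nbrSum g x)

  boundary : Subset n → ℕ
  boundary p = adjForm (χ p) (χ (∁ p))

  adjℕ-irrefl : ∀ x → adjℕ x x ≡ 0
  adjℕ-irrefl x = cong 𝟙 (irrefl L x)

  nbrSum-cong : ∀ {f g} → (∀ i → f i ≡ g i) → ∀ x → nbrSum f x ≡ nbrSum g x
  nbrSum-cong f≗g x = sum-cong-≗ (λ y → cong (adjℕ x y *_) (f≗g y))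

  nbrSum-+ : ∀ f g x → nbrSum (λ i → f i + g i) x ≡ nbrSum f x + nbrSum g x
  nbrSum-+ f g x = trans (sum-cong-≗ (λ y → *-distribˡ-+ (adjℕ x y) (f y) (g y)))
                         (∑-distrib-+ (λ y → adjℕ x y * f y) (λ y → adjℕ x y * g y))

  nbrSum-χ⁅⁆ : ∀ v x → nbrSum (χ ⁅ v ⁆) x ≡ adjℕ x v
  nbrSum-χ⁅⁆ v x = ∑-χ⁅⁆ʳ v (adjℕ x)

  deg≡nbrSum : ∀ x → deg L x ≡ nbrSum (λ _ → 1) x
  deg≡nbrSum x = trans (∣p∣≡∑χ (nbhd L x)) (sum-cong-≗ λ y →
    trans (cong 𝟙 (lookup∘tabulate (adj L x) y)) (sym (*-identityʳ (adjℕ x y))))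

  degIn≡nbrSum : ∀ U x → degIn L U x ≡ nbrSum (χ U) x
  degIn≡nbrSum U x = trans (∣p∣≡∑χ (U ∩ nbhd L x)) (sum-cong-≗ λ y → begin
    χ (U ∩ nbhd L x) y     ≡⟨ χ-∩ U (nbhd L x) y ⟩
    χ U y * χ (nbhd L x) y ≡⟨ cong (λ b → χ U y * 𝟙 b) (lookup∘tabulate (adj L x) y) ⟩
    χ U y * adjℕ x y       ≡⟨ *-comm (χ U y) (adjℕ x y) ⟩
    adjℕ x y * χ U y       ∎)
    where open ≡-Reasoning

  adjForm-cong : ∀ {f f′ g g′} → (∀ i → f i ≡ f′ i) → (∀ i → g i ≡ g′ i) → adjForm f g ≡ adjForm f′ g′
  adjForm-cong f≗f′ g≗g′ = sum-cong-≗ (λ x → cong₂ _*_ (f≗f′ x) (nbrSum-cong g≗g′ x))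

  adjForm-+ˡ : ∀ f f′ g → adjForm (λ i → f i + f′ i) g ≡ adjForm f g + adjForm f′ g
  adjForm-+ˡ f f′ g = trans (sum-cong-≗ (λ x → *-distribʳ-+ (nbrSum g x) (f x) (f′ x)))
                            (∑-distrib-+ (λ x → f x * nbrSum g x) (λ x → f′ x * nbrSum g x))

  adjForm-+ʳ : ∀ f g g′ → adjForm f (λ i → g i + g′ i) ≡ adjForm f g + adjForm f g′
  adjForm-+ʳ f g g′ = trans (sum-cong-≗ (λ x → trans (cong (f x *_) (nbrSum-+ g g′ x)) (*-distribˡ-+ (f x) _ _)))
                            (∑-distrib-+ (λ x → f x * nbrSum g x) (λ x → f x * nbrSum g′ x))

  adjForm-χ⁅⁆ˡ : ∀ v g → adjForm (χ ⁅ v ⁆) g ≡ nbrSum g v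
  adjForm-χ⁅⁆ˡ v g = ∑-χ⁅⁆ˡ v (nbrSum g)

  adjForm-χ⁅⁆ʳ : ∀ f v → adjForm f (χ ⁅ v ⁆) ≡ nbrSum f v
  adjForm-χ⁅⁆ʳ f v = sum-cong-≗ λ x → begin
    f x * nbrSum (χ ⁅ v ⁆) x ≡⟨ cong (f x *_) (nbrSum-χ⁅⁆ v x) ⟩
    f x * adjℕ x v           ≡⟨ *-comm (f x) (adjℕ x v) ⟩
    adjℕ x v * f x           ≡⟨ cong (λ b → 𝟙 b * f x) (adj-sym L x v) ⟩
    adjℕ v x * f x           ∎
    where open ≡-Reasoning

  boundary+interior : ∀ {d} → Regular L d → ∀ p → boundary p + adjForm (χ p) (χ p) ≡ ∣ p ∣ * d
  boundary+interior {d} regular p = begin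
    boundary p + adjForm (χ p) (χ p)          ≡⟨ adjForm-+ʳ (χ p) (χ (∁ p)) (χ p) ⟨
    adjForm (χ p) (λ i → χ (∁ p) i + χ p i)   ≡⟨ adjForm-cong {χ p} (λ _ → refl) (χ-∁ p) ⟩
    adjForm (χ p) (λ _ → 1)                   ≡⟨ sum-cong-≗ (λ x → cong (χ p x *_) (trans (sym (deg≡nbrSum x)) (regular x))) ⟩
    ∑[ x < n ] (χ p x * d)                    ≡⟨ *-distribʳ-sum d (χ p) ⟨
    (∑[ x < n ] χ p x) * d                    ≡⟨ cong (_* d) (∣p∣≡∑χ p) ⟨
    ∣ p ∣ * d                                 ∎
    where open ≡-Reasoning

  adjForm-+χ⁅⁆ : ∀ t v → let s = λ i → t i + χ ⁅ v ⁆ i in adjForm s s ≡ adjForm t t + 2 * nbrSum t v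
  adjForm-+χ⁅⁆ t v = begin
    adjForm s s                                           ≡⟨ adjForm-+ˡ t δ s ⟩
    adjForm t s + adjForm δ s                             ≡⟨ cong₂ _+_ (adjForm-+ʳ t t δ) (adjForm-+ʳ δ t δ) ⟩
    (adjForm t t + adjForm t δ) + (adjForm δ t + adjForm δ δ)
      ≡⟨ cong₂ _+_ (cong (adjForm t t +_) (adjForm-χ⁅⁆ʳ t v)) (cong₂ _+_ (adjForm-χ⁅⁆ˡ v t) (adjForm-χ⁅⁆ˡ v δ)) ⟩
    (adjForm t t + nbrSum t v) + (nbrSum t v + nbrSum δ v) ≡⟨ cong (λ z → (adjForm t t + nbrSum t v) + (nbrSum t v + z))
                                                                   (trans (nbrSum-χ⁅⁆ v v) (adjℕ-irrefl v)) ⟩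
    (adjForm t t + nbrSum t v) + (nbrSum t v + 0)          ≡⟨ solve 2 (λ a b → (a :+ b) :+ (b :+ con 0) := a :+ con 2 :* b) refl
                                                                    (adjForm t t) (nbrSum t v) ⟩
    adjForm t t + 2 * nbrSum t v                           ∎
    where
    open ≡-Reasoning
    δ s : Fin n → ℕ
    δ = χ ⁅ v ⁆
    s i = t i + δ i

-- Moves of a particle configuration

module _ {n : ℕ} (L : Graph n) (p : Subset n) where

  MoveAt : Subset n → Fin n → Fin n → Set
  MoveAt s a b = a ∈ p × adj L a b ≡ true × b ∉ p × s ≡ p △ (⁅ a ⁆ ∪ ⁅ b ⁆)

  moveAt? : ∀ s a b → Dec (MoveAt s a b)
  moveAt? s a b = a ∈? p ×-dec adj L a b BoolP.≟ true ×-dec ¬? (b ∈? p) ×-dec ≡-dec BoolP._≟_ s (p △ (⁅ a ⁆ ∪ ⁅ b ⁆))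

  ∣p△⁅⁆∪⁅⁆∣≡∣p∣ : ∀ {a b} → a ∈ p → b ∉ p → ∣ p △ (⁅ a ⁆ ∪ ⁅ b ⁆) ∣ ≡ ∣ p ∣
  ∣p△⁅⁆∪⁅⁆∣≡∣p∣ {a} {b} a∈p b∉p = +-cancelʳ-≡ 2 _ _ (begin
    ∣ p △ (⁅ a ⁆ ∪ ⁅ b ⁆) ∣ + 2 * (1 + 0)            ≡⟨ cong₂ (λ u v → ∣ p △ (⁅ a ⁆ ∪ ⁅ b ⁆) ∣ + 2 * (𝟙 u + 𝟙 v))
                                                           ([]=⇒lookup a∈p) (∉⇒lookup≡false b∉p) ⟨
    ∣ p △ (⁅ a ⁆ ∪ ⁅ b ⁆) ∣ + 2 * (χ p a + χ p b)    ≡⟨ ∣p△⁅⁆∪⁅⁆∣ p (∈∧∉⇒≢ a∈p b∉p) ⟩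
    ∣ p ∣ + 2                                        ∎)
    where open ≡-Reasoning

  moveAt⇒edge : ∀ {s a b} → MoveAt s a b → ∣ s ∣ ≡ ∣ p ∣ × PEdge L p s
  moveAt⇒edge (a∈p , ab , b∉p , refl) = ∣p△⁅⁆∪⁅⁆∣≡∣p∣ a∈p b∉p , (_ , _ , ab , △-involutive p _)

  edge⇒moveAt : ∀ {s} → ∣ s ∣ ≡ ∣ p ∣ → PEdge L p s → Σ (Fin n) λ a → Σ (Fin n) (MoveAt s a)
  edge⇒moveAt {s} ∣s∣≡∣p∣ (x , y , xy , p△s≡r) = orient (χ+χ≡1⇒one-in p one-endpoint-in-p)
    where
    x≢y : x ≢ y
    x≢y refl with () ← trans (sym xy) (irrefl L x)
    s≡p△r : s ≡ p △ (⁅ x ⁆ ∪ ⁅ y ⁆)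
    s≡p△r = trans (sym (△-involutive p s)) (cong (p △_) p△s≡r)
    one-endpoint-in-p : χ p x + χ p y ≡ 1
    one-endpoint-in-p = *-cancelˡ-≡ _ 1 2 (+-cancelˡ-≡ ∣ p ∣ _ _ (begin
      ∣ p ∣ + 2 * (χ p x + χ p y)                    ≡⟨ cong (_+ 2 * (χ p x + χ p y)) ∣s∣≡∣p∣ ⟨
      ∣ s ∣ + 2 * (χ p x + χ p y)                    ≡⟨ cong (λ z → ∣ z ∣ + 2 * (χ p x + χ p y)) s≡p△r ⟩
      ∣ p △ (⁅ x ⁆ ∪ ⁅ y ⁆) ∣ + 2 * (χ p x + χ p y)  ≡⟨ ∣p△⁅⁆∪⁅⁆∣ p x≢y ⟩
      ∣ p ∣ + 2                                      ∎))
      where open ≡-Reasoning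
    orient : (x ∈ p × y ∉ p) ⊎ (y ∈ p × x ∉ p) → Σ (Fin n) λ a → Σ (Fin n) (MoveAt s a)
    orient (inj₁ (x∈p , y∉p)) = x , y , x∈p , xy , y∉p , s≡p△r
    orient (inj₂ (y∈p , x∉p)) = y , x , y∈p , trans (adj-sym L y x) xy , x∉p ,
                                trans s≡p△r (cong (p △_) (∪-comm ⁅ x ⁆ ⁅ y ⁆))

  moveAt-unique : ∀ {s a b a′ b′} → MoveAt s a b → a′ ∈ p → b′ ∉ p → p △ s ≡ ⁅ a′ ⁆ ∪ ⁅ b′ ⁆ → a ≡ a′ × b ≡ b′
  moveAt-unique (a∈p , _ , b∉p , refl) a′∈p b′∉p p△s≡r′ =
    ⁅⁆∪⁅⁆-endpoints a∈p b∉p a′∈p b′∉p (trans (sym (△-involutive p _)) p△s≡r′)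

  ∑₂-moveAt≡1 : ∀ {s x y} → MoveAt s x y → ∑[ a < n ] ∑[ b < n ] 𝟙 (does (moveAt? s a b)) ≡ 1
  ∑₂-moveAt≡1 {s} {x} {y} move@(x∈p , _ , y∉p , s≡p△r) =
    trans (∑₂-concentrated _ x y other-pairs) (𝟙-yes (moveAt? s x y) move)
    where
    other-pairs : ∀ a b → a ≢ x ⊎ b ≢ y → 𝟙 (does (moveAt? s a b)) ≡ 0
    other-pairs a b a≢x⊎b≢y = 𝟙-no (moveAt? s a b) λ move′ →
      let a≡x , b≡y = moveAt-unique move′ x∈p y∉p (trans (cong (p △_) s≡p△r) (△-involutive p _))
      in Sum.[ (λ a≢x → a≢x a≡x) , (λ b≢y → b≢y b≡y) ] a≢x⊎b≢y

  edge-indicator : ∀ {k} → ∣ p ∣ ≡ k → ∀ s →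
                   𝟙 (does ((∣ s ∣ ℕ.≟ k) ×-dec PEdge? L p s)) ≡ ∑[ a < n ] ∑[ b < n ] 𝟙 (does (moveAt? s a b))
  edge-indicator {k} ∣p∣≡k s = by-cases ((∣ s ∣ ℕ.≟ k) ×-dec PEdge? L p s)
    where
    by-cases : (edge? : Dec (∣ s ∣ ≡ k × PEdge L p s)) → 𝟙 (does edge?) ≡ ∑[ a < n ] ∑[ b < n ] 𝟙 (does (moveAt? s a b))
    by-cases (yes (∣s∣≡k , edge)) =
      let _ , _ , move = edge⇒moveAt (trans ∣s∣≡k (sym ∣p∣≡k)) edge in sym (∑₂-moveAt≡1 move)
    by-cases (no ¬edge) = sym (∑-zero λ a → ∑-zero λ b → 𝟙-no (moveAt? s a b) λ move →
      ¬edge (Product.map₁ (λ ∣s∣≡∣p∣ → trans ∣s∣≡∣p∣ ∣p∣≡k) (moveAt⇒edge move)))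

  moveAt-weight : ∀ a b → 𝟙 (does (moveAt? (p △ (⁅ a ⁆ ∪ ⁅ b ⁆)) a b)) ≡ χ p a * (adjℕ L a b * χ (∁ p) b)
  moveAt-weight a b = begin
    𝟙 (does (a ∈? p) ∧ does (adj L a b BoolP.≟ true) ∧ not (does (b ∈? p)) ∧ does (≡-dec BoolP._≟_ t t))
      ≡⟨ cong₂ (λ u v → 𝟙 (u ∧ v)) (does-∈? a p)
           (cong₂ _∧_ (does-≟true (adj L a b))
             (cong₂ _∧_ (trans (cong not (does-∈? b p)) (sym (lookup-map b not p))) (dec-true (≡-dec BoolP._≟_ t t) refl))) ⟩
    𝟙 (lookup p a ∧ adj L a b ∧ lookup (∁ p) b ∧ true)
      ≡⟨ 𝟙-∧ (lookup p a) _ ⟩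
    χ p a * 𝟙 (adj L a b ∧ lookup (∁ p) b ∧ true)
      ≡⟨ cong (χ p a *_) (trans (𝟙-∧ (adj L a b) _) (cong (λ u → adjℕ L a b * 𝟙 u) (∧-identityʳ (lookup (∁ p) b)))) ⟩
    χ p a * (adjℕ L a b * χ (∁ p) b)
      ∎
    where
    open ≡-Reasoning
    t : Subset n
    t = p △ (⁅ a ⁆ ∪ ⁅ b ⁆)
    does-≟true : ∀ c → does (c BoolP.≟ true) ≡ c
    does-≟true true  = refl
    does-≟true false = refl

  degK≡boundary : ∀ {k} → ∣ p ∣ ≡ k → degK L k p ≡ boundary L p
  degK≡boundary {k} ∣p∣≡k = begin
    degK L k p
      ≡⟨ length-filter≡sum (λ s → (∣ s ∣ ℕ.≟ k) ×-dec PEdge? L p s) (allSubsets n) ⟩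
    ∑ₛ (λ s → 𝟙 (does ((∣ s ∣ ℕ.≟ k) ×-dec PEdge? L p s)))
      ≡⟨ cong sumᴸ (map-cong (edge-indicator ∣p∣≡k) (allSubsets n)) ⟩
    ∑ₛ (λ s → ∑[ a < n ] ∑[ b < n ] move s a b)
      ≡⟨ sumᴸ-∑-comm (λ s a → ∑[ b < n ] move s a b) (allSubsets n) ⟩
    ∑[ a < n ] ∑ₛ (λ s → ∑[ b < n ] move s a b)
      ≡⟨ sum-cong-≗ (λ a → sumᴸ-∑-comm (λ s b → move s a b) (allSubsets n)) ⟩
    ∑[ a < n ] ∑[ b < n ] ∑ₛ (λ s → move s a b)
      ≡⟨ sum-cong-≗ (λ a → sum-cong-≗ λ b →
           ∑ₛ-concentrated (λ s → move s a b) _ λ s s≢t → 𝟙-no (moveAt? s a b) (s≢t ∘ proj₂ ∘ proj₂ ∘ proj₂)) ⟩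
    ∑[ a < n ] ∑[ b < n ] move (p △ (⁅ a ⁆ ∪ ⁅ b ⁆)) a b
      ≡⟨ sum-cong-≗ (λ a → sum-cong-≗ (moveAt-weight a)) ⟩
    ∑[ a < n ] ∑[ b < n ] (χ p a * (adjℕ L a b * χ (∁ p) b))
      ≡⟨ sum-cong-≗ (λ a → *-distribˡ-sum (χ p a) (λ b → adjℕ L a b * χ (∁ p) b)) ⟨
    boundary L p
      ∎
    where
    open ≡-Reasoning
    move : Subset n → Fin n → Fin n → ℕ
    move s a b = 𝟙 (does (moveAt? s a b))

edge-endpoints-adjacent : ∀ {n} (L : Graph n) {p q v w} → ∣ q ∣ ≡ ∣ p ∣ → PEdge L p q →
                          p △ q ≡ ⁅ v ⁆ ∪ ⁅ w ⁆ → v ∈ p → w ∈ q → adj L v w ≡ true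
edge-endpoints-adjacent L {p} {q} {v} {w} ∣q∣≡∣p∣ edge p△q≡r v∈p w∈q
  with edge⇒moveAt L p ∣q∣≡∣p∣ edge
... | _ , _ , move@(_ , a~b , _ , _)
  with moveAt-unique L p move v∈p (∈q∧∈p△q⇒∉p w∈q (subst (w ∈_) (sym p△q≡r) (x∈p∪q⁺ (inj₂ (x∈⁅x⁆ w))))) p△q≡r
... | refl , refl = a~b

module _ {n d : ℕ} (L : Graph n) (regular : Regular L d) (p : Subset n) (t : Fin n → ℕ) (v : Fin n)
         (split : ∀ i → χ p i ≡ t i + χ ⁅ v ⁆ i) where

  degIn≡nbrSum-rest : degIn L p v ≡ nbrSum L t v
  degIn≡nbrSum-rest = begin
    degIn L p v                                ≡⟨ degIn≡nbrSum L p v ⟩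
    nbrSum L (χ p) v                           ≡⟨ nbrSum-cong L split v ⟩
    nbrSum L (λ i → t i + χ ⁅ v ⁆ i) v         ≡⟨ nbrSum-+ L t (χ ⁅ v ⁆) v ⟩
    nbrSum L t v + nbrSum L (χ ⁅ v ⁆) v        ≡⟨ cong (nbrSum L t v +_) (trans (nbrSum-χ⁅⁆ L v v) (adjℕ-irrefl L v)) ⟩
    nbrSum L t v + 0                           ≡⟨ +-identityʳ _ ⟩
    nbrSum L t v                               ∎
    where open ≡-Reasoning

  degK+2degIn : ∀ {k} → ∣ p ∣ ≡ k → degK L k p + (adjForm L t t + 2 * degIn L p v) ≡ k * d
  degK+2degIn {k} ∣p∣≡k = begin
    degK L k p + (adjForm L t t + 2 * degIn L p v)      ≡⟨ cong₂ (λ x y → x + (adjForm L t t + 2 * y)) (degK≡boundary L p ∣p∣≡k) degIn≡nbrSum-rest ⟩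
    boundary L p + (adjForm L t t + 2 * nbrSum L t v)   ≡⟨ cong (boundary L p +_) (adjForm-+χ⁅⁆ L t v) ⟨
    boundary L p + adjForm L s s                        ≡⟨ cong (boundary L p +_) (adjForm-cong L split split) ⟨
    boundary L p + adjForm L (χ p) (χ p)                ≡⟨ boundary+interior L regular p ⟩
    ∣ p ∣ * d                                           ≡⟨ cong (_* d) ∣p∣≡k ⟩
    k * d                                               ∎
    where
    open ≡-Reasoning
    s : Fin n → ℕ
    s i = t i + χ ⁅ v ⁆ i

  degIn+degIn∁+1 : ∀ q w → (∀ i → χ q i ≡ t i + χ ⁅ w ⁆ i) → adj L v w ≡ true →
                   degIn L p v + degIn L (∁ q) v + 1 ≡ d
  degIn+degIn∁+1 q w split′ v~w = begin
    degIn L p v + degIn L (∁ q) v + 1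
      ≡⟨ cong₂ _+_ (cong₂ _+_ (degIn≡nbrSum L p v) (degIn≡nbrSum L (∁ q) v))
                   (trans (cong 𝟙 (sym v~w)) (sym (nbrSum-χ⁅⁆ L w v))) ⟩
    nbrSum L (χ p) v + nbrSum L (χ (∁ q)) v + nbrSum L (χ ⁅ w ⁆) v
      ≡⟨ trans (nbrSum-+ L (λ i → χ p i + χ (∁ q) i) (χ ⁅ w ⁆) v)
               (cong (_+ nbrSum L (χ ⁅ w ⁆) v) (nbrSum-+ L (χ p) (χ (∁ q)) v)) ⟨
    nbrSum L (λ i → χ p i + χ (∁ q) i + χ ⁅ w ⁆ i) v
      ≡⟨ nbrSum-cong L pointwise v ⟩
    nbrSum L (λ i → χ ⁅ v ⁆ i + 1) v
      ≡⟨ nbrSum-+ L (χ ⁅ v ⁆) (λ _ → 1) v ⟩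
    nbrSum L (χ ⁅ v ⁆) v + nbrSum L (λ _ → 1) v
      ≡⟨ cong₂ _+_ (trans (nbrSum-χ⁅⁆ L v v) (adjℕ-irrefl L v)) (trans (sym (deg≡nbrSum L v)) (regular v)) ⟩
    d ∎
    where
    open ≡-Reasoning
    pointwise : ∀ i → χ p i + χ (∁ q) i + χ ⁅ w ⁆ i ≡ χ ⁅ v ⁆ i + 1
    pointwise i = begin
      χ p i + χ (∁ q) i + χ ⁅ w ⁆ i                ≡⟨ cong (λ x → x + χ (∁ q) i + χ ⁅ w ⁆ i) (split i) ⟩
      t i + χ ⁅ v ⁆ i + χ (∁ q) i + χ ⁅ w ⁆ i       ≡⟨ solve 4 (λ a b c e → a :+ b :+ c :+ e := b :+ (c :+ (a :+ e))) refl
                                                          (t i) (χ ⁅ v ⁆ i) (χ (∁ q) i) (χ ⁅ w ⁆ i) ⟩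
      χ ⁅ v ⁆ i + (χ (∁ q) i + (t i + χ ⁅ w ⁆ i))   ≡⟨ cong (λ x → χ ⁅ v ⁆ i + (χ (∁ q) i + x)) (split′ i) ⟨
      χ ⁅ v ⁆ i + (χ (∁ q) i + χ q i)               ≡⟨ cong (χ ⁅ v ⁆ i +_) (χ-∁ q i) ⟩
      χ ⁅ v ⁆ i + 1                                 ∎

+-2*-cancel-⇔ : ∀ {x y a b} c → x + (c + 2 * a) ≡ y + (c + 2 * b) → (x ≡ y ⇔ a ≡ b)
+-2*-cancel-⇔ {x} {y} {a} {b} c balance = mk⇔
  (λ { refl → *-cancelˡ-≡ a b 2 (+-cancelˡ-≡ c _ _ (+-cancelˡ-≡ x _ _ balance)) })
  (λ { refl → +-cancelʳ-≡ (c + 2 * a) x y balance })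

proposition5p4 : (n d : ℕ) (L : Graph n) → Connected L → Regular L d →
    (k : ℕ) → 1 ≤ k → k < n →
    (𝔳 𝔴 : Subset n) → ∣ 𝔳 ∣ ≡ k → ∣ 𝔴 ∣ ≡ k → PEdge L 𝔳 𝔴 →
    (v w : Fin n) → 𝔳 △ 𝔴 ≡ ⁅ v ⁆ ∪ ⁅ w ⁆ → v ∈ 𝔳 → w ∈ 𝔴 →
    ((degK L k 𝔳 ≡ degK L k 𝔴) ⇔ (degIn L 𝔳 v ≡ degIn L 𝔴 w))
    × (degIn L 𝔳 v + degIn L (∁ 𝔴) v ≡ d ∸ 1)
proposition5p4 n d L _ regular k _ _ 𝔳 𝔴 ∣𝔳∣≡k ∣𝔴∣≡k edge v w 𝔳△𝔴 v∈𝔳 w∈𝔴 =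
  +-2*-cancel-⇔ (adjForm L common common) balance ,
  trans (sym (m+n∸n≡m _ 1)) (cong (_∸ 1) (degIn+degIn∁+1 L regular 𝔳 common v split𝔳 𝔴 w split𝔴 v~w))
  where
  common : Fin n → ℕ
  common = χ (𝔳 ∩ 𝔴)
  split𝔳 : ∀ i → χ 𝔳 i ≡ common i + χ ⁅ v ⁆ i
  split𝔳 = χ-split 𝔳△𝔴 v∈𝔳 w∈𝔴
  split𝔴 : ∀ i → χ 𝔴 i ≡ common i + χ ⁅ w ⁆ i
  split𝔴 i = trans (χ-split (△-flip 𝔳△𝔴) w∈𝔴 v∈𝔳 i) (cong (λ r → χ r i + χ ⁅ w ⁆ i) (∩-comm 𝔴 𝔳))
  balance : degK L k 𝔳 + (adjForm L common common + 2 * degIn L 𝔳 v)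
          ≡ degK L k 𝔴 + (adjForm L common common + 2 * degIn L 𝔴 w)
  balance = trans (degK+2degIn L regular 𝔳 common v split𝔳 ∣𝔳∣≡k)
                  (sym (degK+2degIn L regular 𝔴 common w split𝔴 ∣𝔴∣≡k))
  v~w : adj L v w ≡ true
  v~w = edge-endpoints-adjacent L (trans ∣𝔴∣≡k (sym ∣𝔳∣≡k)) edge 𝔳△𝔴 v∈𝔳 w∈𝔴
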